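{- Let $\mathbf x$ be an extreme point of a 0/1-LP $\min\{\mathbf c^{\intercal}\mathbf x: A\mathbf x=\mathbf b,\ B\mathbf x\le\mathbf d,\ \mathbf x\in\mathbb R^n\}$ with $n$ variables. Then a maximal augmentation at $\mathbf x$ along a steepest edge is an $n$-approximate greatest-improvement augmentation at $\mathbf x$.
   Context: A 0/1-LP is an LP whose feasible region $\mathcal P$ is a 0/1 polytope (all vertices in $\{0,1\}^n$). Standing assumptions: $A,B,\mathbf b,\mathbf d,\mathbf c$ integral, $A$ of full row rank, $\binom{A}{B}$ of rank $n$. Circuits: nonzero $\mathbf g\in\ker(A)$ with $B\mathbf g$ support-minimal in $\{B\mathbf y:\mathbf y\in\ker A,\mathbf y\ne\mathbf 0\}$; $\mathcal C(A,B)$ is the set of circuits with co-prime integer components. The edge-directions at a vertex $\mathbf x$ are the extreme rays of the feasible cone $\{\mathbf z: A\mathbf z=\mathbf 0,\ B_T\mathbf z\le\mathbf 0\}$, $T$ the indices of inequalities tight at $\mathbf x$; a steepest edge is an edge-direction $\mathbf g$ minimizing $\mathbf c^{\intercal}\mathbf g/\|\mathbf g\|_1$. A maximal augmentation along $\mathbf g$ is $\alpha\mathbf g$ with $\alpha>0$ largest such that $\mathbf x+\alpha\mathbf g\in\mathcal P$. A greatest-improvement augmentation $\alpha^*\mathbf g^*$ maximizes $-\mathbf c^{\intercal}(\alpha\mathbf g)$ over $\mathbf g\in\mathcal C(A,B)$, $\alpha>0$, $\mathbf x+\alpha\mathbf g\in\mathcal P$; an augmentation $\alpha\mathbf g$ is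 $\gamma$-approximate greatest-improvement if $\mathbf c^{\intercal}\mathbf x-\mathbf c^{\intercal}(\mathbf x+\alpha\mathbf g)\ge\frac1\gamma(\mathbf c^{\intercal}\mathbf x-\mathbf c^{\intercal}(\mathbf x+\alpha^*\mathbf g^*))$.
   Formalization: Points, edge-directions and step lengths, including x, α, α* and all competitors in the definitions of extreme point, steepest edge and greatest improvement, have rational coordinates and values rather than real ones. -}

module Defs where

open import Data.Nat as ℕ using (ℕ; zero; suc)
open import Data.Nat.Divisibility using (_∣_)
open import Data.Integer as ℤ using (ℤ)
open import Data.Fin using (Fin; zero; suc)
open import Data.Rational as ℚ using (ℚ; 0ℚ; 1ℚ; _+_; _*_; _-_; _≤_; _<_; ∣_∣)
open import Data.Product using (_×_; Σ; ∃; ∃-syntax; _,_)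
open import Relation.Binary.PropositionalEquality using (_≡_; _≢_)
open import Relation.Nullary using (¬_)
open import Data.Sum using (_⊎_)

Vecℚ : ℕ → Set
Vecℚ k = Fin k → ℚ

ι : ℤ → ℚ
ι z = z ℚ./ 1

Σℚ : (k : ℕ) → (Fin k → ℚ) → ℚ
Σℚ zero    f = 0ℚ
Σℚ (suc k) f = f zero + Σℚ k (λ i → f (suc i))

_·_ : ∀ {m k} → (Fin m → Fin k → ℤ) → Vecℚ k → Vecℚ m
_·_ {k = k} M v i = Σℚ k (λ j → ι (M i j) * v j)

dot : ∀ {k} → (Fin k → ℤ) → Vecℚ k → ℚ
dot {k} c v = Σℚ k (λ j → ι (c j) * v j)

norm1 : ∀ {k} → Vecℚ k → ℚ
norm1 {k} v = Σℚ k (λ j → ∣ v j ∣)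

zeroV : ∀ {k} → Vecℚ k
zeroV _ = 0ℚ

_+ᵥ_ : ∀ {k} → Vecℚ k → Vecℚ k → Vecℚ k
(u +ᵥ v) i = u i + v i

_∙ᵥ_ : ∀ {k} → ℚ → Vecℚ k → Vecℚ k
(a ∙ᵥ v) i = a * v i

-- The LP data  min { cᵀx : A x = b, B x ≤ d }, with integral A, B, b, d, c.
record LP (n : ℕ) : Set where
  field
    mA mB : ℕ
    A : Fin mA → Fin n → ℤ
    b : Fin mA → ℤ
    B : Fin mB → Fin n → ℤ
    d : Fin mB → ℤ
    c : Fin n → ℤ

module _ {n : ℕ} (L : LP n) where
  open LP L

  Feasible : Vecℚ n → Set
  Feasible x = (∀ i → (A · x) i ≡ ι (b i)) × (∀ j → (B · x) j ≤ ι (d j))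

  FullRowRankA : Set
  FullRowRankA = ∀ (y : Vecℚ mA) → (∀ j → Σℚ mA (λ i → y i * ι (A i j)) ≡ 0ℚ) → ∀ i → y i ≡ 0ℚ

  RankStackedN : Set
  RankStackedN = ∀ (z : Vecℚ n) → (∀ i → (A · z) i ≡ 0ℚ) → (∀ j → (B · z) j ≡ 0ℚ) → ∀ k → z k ≡ 0ℚ

  ExtremePoint : Vecℚ n → Set
  ExtremePoint x = Feasible x ×
    (∀ y z (λ' : ℚ) → Feasible y → Feasible z → 0ℚ < λ' → λ' < 1ℚ →
       (∀ i → x i ≡ λ' * y i + (1ℚ - λ') * z i) → ∀ i → y i ≡ z i)

  Bounded : Set
  Bounded = ∃[ M ] (∀ x → Feasible x → ∀ i → ∣ x i ∣ ≤ M)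

  ZeroOnePolytope : Set
  ZeroOnePolytope = Bounded × (∀ x → ExtremePoint x → ∀ i → (x i ≡ 0ℚ) ⊎ (x i ≡ 1ℚ))

  InKerA : Vecℚ n → Set
  InKerA g = ∀ i → (A · g) i ≡ 0ℚ

  NonZeroV : ∀ {k} → Vecℚ k → Set
  NonZeroV v = ¬ (∀ i → v i ≡ 0ℚ)

  _⊆supp_ : ∀ {k} → Vecℚ k → Vecℚ k → Set
  u ⊆supp v = ∀ i → u i ≢ 0ℚ → v i ≢ 0ℚ

  Circuit : Vecℚ n → Set
  Circuit g = InKerA g × NonZeroV g ×
    (∀ y → InKerA y → NonZeroV y → (B · y) ⊆supp (B · g) → (B · g) ⊆supp (B · y))

  InC : (Fin n → ℤ) → Set
  InC g = Circuit (λ i → ι (g i)) × (∀ (k : ℕ) → (∀ i → k ∣ ℤ.∣ g i ∣) → k ≡ 1)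

  InCone : Vecℚ n → Vecℚ n → Set
  InCone x z = InKerA z × (∀ j → (B · x) j ≡ ι (d j) → (B · z) j ≤ 0ℚ)

  -- edge-direction at x: extreme ray of the feasible cone
  EdgeDirection : Vecℚ n → Vecℚ n → Set
  EdgeDirection x g = InCone x g × NonZeroV g ×
    (∀ u v → InCone x u → InCone x v → (∀ i → g i ≡ u i + v i) →
       (∃[ λ₁ ] (0ℚ ≤ λ₁ × ∀ i → u i ≡ λ₁ * g i)) × (∃[ λ₂ ] (0ℚ ≤ λ₂ × ∀ i → v i ≡ λ₂ * g i)))

  -- steepest edge: edge-direction minimising cᵀg / ‖g‖₁ (cross-multiplied; both norms > 0)
  SteepestEdge : Vecℚ n → Vecℚ n → Set
  SteepestEdge x g = EdgeDirection x g ×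
    (∀ h → EdgeDirection x h → dot c g * norm1 h ≤ dot c h * norm1 g)

  MaximalAugmentation : Vecℚ n → ℚ → Vecℚ n → Set
  MaximalAugmentation x α g = 0ℚ < α × Feasible (x +ᵥ (α ∙ᵥ g)) ×
    (∀ β → Feasible (x +ᵥ (β ∙ᵥ g)) → β ≤ α)

  improvement : Vecℚ n → ℚ → Vecℚ n → ℚ
  improvement x α g = dot c x - dot c (x +ᵥ (α ∙ᵥ g))

  GreatestImprovement : Vecℚ n → ℚ → (Fin n → ℤ) → Set
  GreatestImprovement x α* g* = InC g* × 0ℚ < α* × Feasible (x +ᵥ (α* ∙ᵥ (λ i → ι (g* i)))) ×
    (∀ g α → InC g → 0ℚ < α → Feasible (x +ᵥ (α ∙ᵥ (λ i → ι (g i)))) →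
       improvement x α (λ i → ι (g i)) ≤ improvement x α* (λ i → ι (g* i)))

  -- γ-approximate greatest-improvement augmentation (γ > 0; the factor 1/γ is multiplied out)
  ApproxGreatestImprovement : ℚ → Vecℚ n → ℚ → Vecℚ n → Set
  ApproxGreatestImprovement γ x α g = ∀ α* g* → GreatestImprovement x α* g* →
    improvement x α* (λ i → ι (g* i)) ≤ γ * improvement x α g

module Submission where

-- Every feasible point lies in [0,1]ⁿ: a linear functional that is bounded below at the
-- vertices of a bounded polyhedron is bounded below on all of it. So at the 0/1 vertex x, with
-- s_k = 1 where x_k = 0 and s_k = −1 where x_k = 1, every direction z of the feasible cone has
-- ‖z‖₁ = sᵀz. The vertices of the slice {z in the cone : sᵀz = 1} are edge directions, and the
-- same vertex principle applied on the slice to ‖g‖₁cᵀz − (cᵀg)sᵀz turns the steepest-edge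
-- property of g into cᵀg‖z‖₁ ≤ ‖g‖₁cᵀz on the whole cone. The maximal step x + αg is again a
-- vertex, hence a 0/1 point, so α‖g‖₁ ≥ 1. A greatest-improvement step y = α*g* lies in the
-- cone, is descending, and has ‖y‖₁ ≤ n; together −cᵀy ≤ n·(−α cᵀg).

open import Defs
open import Data.Nat using (ℕ)
open import Data.Integer using (+_)
open import Data.Rational using (ℚ)

open import Algebra.Bundles using (CommutativeRing)
open import Data.Empty using (⊥; ⊥-elim)
open import Data.Fin using (Fin; zero; suc)
open import Data.Fin.Properties using (any?; all?; ¬∀⟶∃¬)
open import Data.Integer as ℤ using (ℤ)
open import Data.Nat as ℕ using (zero; suc)
open import Data.Nat.Coprimality using (1-coprimeTo)
import Data.Nat.Coprimality as Coprime
open import Data.Nat.Induction using (<-wellFounded)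
import Data.Nat.Properties as ℕ
open import Induction.WellFounded using (module All)
import Relation.Binary.Construct.On as On
open import Data.Product using (_×_; Σ; ∃; ∃-syntax; _,_; proj₁; proj₂)
open import Data.Rational as ℚ
  using (0ℚ; 1ℚ; _+_; _*_; _-_; -_; _≤_; _<_; ∣_∣; 1/_; ½; mkℚ; positive; nonNegative; ≢-nonZero)
open import Data.Rational.Properties
open import Data.Rational.Solver using (module +-*-Solver)
open import Data.Sum using (_⊎_; inj₁; inj₂)
open import Data.Vec.Functional using (_∷_)
open import Function using (_∘_)
open import Relation.Binary.PropositionalEquality
open import Relation.Nullary using (¬_; Dec; yes; no; contradiction)
open import Relation.Unary using (Decidable)

open +-*-Solver using (solve; _:=_; _:+_; _:*_; _:-_; :-_; con)
open import Algebra.Properties.Semiring.Sum (CommutativeRing.semiring +-*-commutativeRing)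
  using (sum; sum-cong-≗; ∑-distrib-+; *-distribˡ-sum)

-- Ordered-field arithmetic in ℚ

p≤q⇒0≤q-p : ∀ {p q} → p ≤ q → 0ℚ ≤ q - p
p≤q⇒0≤q-p {p} {q} p≤q = subst (_≤ q - p) (+-inverseʳ p) (+-monoˡ-≤ (- p) p≤q)

0≤q-p⇒p≤q : ∀ {p q} → 0ℚ ≤ q - p → p ≤ q
0≤q-p⇒p≤q {p} {q} 0≤q-p =
  subst₂ _≤_ (+-identityˡ p) (solve 2 (λ p q → (q :- p) :+ p := q) refl p q) (+-monoˡ-≤ p 0≤q-p)

q-p≡0⇒p≡q : ∀ {p q} → q - p ≡ 0ℚ → p ≡ q
q-p≡0⇒p≡q {p} {q} q-p≡0 = begin
  p              ≡⟨ solve 2 (λ p q → p := q :- (q :- p)) refl p q ⟩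
  q - (q - p)    ≡⟨ cong (λ s → q - s) q-p≡0 ⟩
  q - 0ℚ         ≡⟨ solve 1 (λ q → q :- con 0ℚ := q) refl q ⟩
  q              ∎
  where open ≡-Reasoning

p<q⇒0<q-p : ∀ {p q} → p < q → 0ℚ < q - p
p<q⇒0<q-p {p} {q} p<q = subst (_< q - p) (+-inverseʳ p) (+-monoˡ-< (- p) p<q)

0<q-p⇒p<q : ∀ {p q} → 0ℚ < q - p → p < q
0<q-p⇒p<q {p} {q} 0<q-p =
  subst₂ _<_ (+-identityˡ p) (solve 2 (λ p q → (q :- p) :+ p := q) refl p q) (+-monoˡ-< p 0<q-p)

≤-by-difference : ∀ {p q r s} → s - r ≡ q - p → r ≤ s → p ≤ q
≤-by-difference eq r≤s = 0≤q-p⇒p≤q (subst (0ℚ ≤_) eq (p≤q⇒0≤q-p r≤s))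

p≤0⇒0≤-p : ∀ {p} → p ≤ 0ℚ → 0ℚ ≤ - p
p≤0⇒0≤-p {p} = ≤-by-difference (solve 1 (λ p → con 0ℚ :- p := :- p :- con 0ℚ) refl p)

≤∧≢⇒< : ∀ {p q} → p ≤ q → p ≢ q → p < q
≤∧≢⇒< {p} {q} p≤q p≢q with q ≤? p
... | yes q≤p = contradiction (≤-antisym p≤q q≤p) p≢q
... | no q≰p = ≰⇒> q≰p

*-nonNeg : ∀ {p q} → 0ℚ ≤ p → 0ℚ ≤ q → 0ℚ ≤ p * q
*-nonNeg {p} {q} 0≤p 0≤q =
  nonNegative⁻¹ _ {{nonNeg*nonNeg⇒nonNeg p {{nonNegative 0≤p}} q {{nonNegative 0≤q}}}}

*-pos : ∀ {p q} → 0ℚ < p → 0ℚ < q → 0ℚ < p * q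
*-pos {p} {q} 0<p 0<q = positive⁻¹ _ {{pos*pos⇒pos p {{positive 0<p}} q {{positive 0<q}}}}

*-monoˡ-≤-0≤ : ∀ {p q} r → 0ℚ ≤ r → p ≤ q → r * p ≤ r * q
*-monoˡ-≤-0≤ r 0≤r = *-monoˡ-≤-nonNeg r {{nonNegative 0≤r}}

*-cancelˡ-≤-0< : ∀ {p q} r → 0ℚ < r → r * p ≤ r * q → p ≤ q
*-cancelˡ-≤-0< r 0<r = *-cancelˡ-≤-pos r {{positive 0<r}}

*-cancelʳ-≡0 : ∀ {p q} → q ≢ 0ℚ → p * q ≡ 0ℚ → p ≡ 0ℚ
*-cancelʳ-≡0 {p} {q} q≢0 pq≡0 = begin
  p              ≡⟨ solve 2 (λ p r → p := p :* con 1ℚ) refl p q ⟩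
  p * 1ℚ         ≡⟨ cong (p *_) (*-inverseʳ q) ⟨
  p * (q * 1/ q) ≡⟨ *-assoc p q (1/ q) ⟨
  p * q * 1/ q   ≡⟨ cong (_* 1/ q) pq≡0 ⟩
  0ℚ * 1/ q      ≡⟨ *-zeroˡ (1/ q) ⟩
  0ℚ             ∎
  where
  open ≡-Reasoning
  instance _ = ≢-nonZero q≢0

*-cancelˡ-≡0-pos : ∀ {p q} → 0ℚ < p → p * q ≡ 0ℚ → q ≡ 0ℚ
*-cancelˡ-≡0-pos {p} {q} 0<p pq≡0 = *-cancelʳ-≡0 (≢-sym (<⇒≢ 0<p)) (trans (*-comm q p) pq≡0)

nonNeg+nonNeg≡0⇒≡0 : ∀ {p q} → 0ℚ ≤ p → 0ℚ ≤ q → p + q ≡ 0ℚ → p ≡ 0ℚ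
nonNeg+nonNeg≡0⇒≡0 {p} {q} 0≤p 0≤q p+q≡0 =
  ≤-antisym (subst₂ _≤_ (+-identityʳ p) p+q≡0 (+-monoʳ-≤ p 0≤q)) 0≤p

∣q-p∣≤1 : ∀ {p q} → 0ℚ ≤ p → p ≤ 1ℚ → 0ℚ ≤ q → q ≤ 1ℚ → ∣ q - p ∣ ≤ 1ℚ
∣q-p∣≤1 {p} {q} 0≤p p≤1 0≤q q≤1 with ∣p∣≡p∨∣p∣≡-p (q - p)
... | inj₁ ∣q-p∣≡q-p = subst (_≤ 1ℚ) (sym ∣q-p∣≡q-p)
  (≤-by-difference (solve 3 (λ p q o → (o :- q) :+ p :- con 0ℚ := o :- (q :- p)) refl p q 1ℚ)
    (+-mono-≤ (p≤q⇒0≤q-p q≤1) 0≤p))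
... | inj₂ ∣q-p∣≡p-q = subst (_≤ 1ℚ) (sym ∣q-p∣≡p-q)
  (≤-by-difference (solve 3 (λ p q o → q :+ (o :- p) :- con 0ℚ := o :- (:- (q :- p))) refl p q 1ℚ)
    (+-mono-≤ 0≤q (p≤q⇒0≤q-p p≤1)))

average-pinned : ∀ {λ' s t a} → 0ℚ < λ' → λ' < 1ℚ → s ≤ a → t ≤ a → λ' * s + (1ℚ - λ') * t ≡ a → s ≡ a
average-pinned {λ'} {s} {t} {a} 0<λ λ<1 s≤a t≤a average≡a = q-p≡0⇒p≡q (*-cancelˡ-≡0-pos 0<λ
  (nonNeg+nonNeg≡0⇒≡0 (*-nonNeg (<⇒≤ 0<λ) (p≤q⇒0≤q-p s≤a))
                       (*-nonNeg (p≤q⇒0≤q-p (<⇒≤ λ<1)) (p≤q⇒0≤q-p t≤a))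
    (begin
      λ' * (a - s) + (1ℚ - λ') * (a - t)   ≡⟨ solve 4 (λ l a s t → l :* (a :- s) :+ (con 1ℚ :- l) :* (a :- t)
                                                              := a :- (l :* s :+ (con 1ℚ :- l) :* t)) refl λ' a s t ⟩
      a - (λ' * s + (1ℚ - λ') * t)         ≡⟨ cong (λ r → a - r) average≡a ⟩
      a - a                                 ≡⟨ +-inverseʳ a ⟩
      0ℚ                                    ∎)))
  where open ≡-Reasoning

1/pos : (p : ℚ) → .(0ℚ < p) → ℚ
1/pos p 0<p = 1/_ p {{pos⇒nonZero p {{positive 0<p}}}}

*-1/pos : ∀ p .(0<p : 0ℚ < p) → p * 1/pos p 0<p ≡ 1ℚ
*-1/pos p 0<p = *-inverseʳ p {{pos⇒nonZero p {{positive 0<p}}}}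

1/pos-pos : ∀ p .(0<p : 0ℚ < p) → 0ℚ < 1/pos p 0<p
1/pos-pos p 0<p = positive⁻¹ _ {{1/pos⇒pos p {{positive 0<p}}}}

*-1/pos-cancel : ∀ a .(0<a : 0ℚ < a) v → a * (1/pos a 0<a * v) ≡ v
*-1/pos-cancel a 0<a v = begin
  a * (1/pos a 0<a * v)   ≡⟨ *-assoc a (1/pos a 0<a) v ⟨
  a * 1/pos a 0<a * v     ≡⟨ cong (_* v) (*-1/pos a 0<a) ⟩
  1ℚ * v                  ≡⟨ *-identityˡ v ⟩
  v                       ∎
  where open ≡-Reasoning

1/pos-*-cancel : ∀ a .(0<a : 0ℚ < a) v → 1/pos a 0<a * (a * v) ≡ v
1/pos-*-cancel a 0<a v = trans (sym (*-assoc (1/pos a 0<a) a v))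
  (trans (cong (_* v) (trans (*-comm (1/pos a 0<a) a) (*-1/pos a 0<a))) (*-identityˡ v))

∣q-p∣≡1 : ∀ {p q} → (p ≡ 0ℚ) ⊎ (p ≡ 1ℚ) → (q ≡ 0ℚ) ⊎ (q ≡ 1ℚ) → q - p ≢ 0ℚ → ∣ q - p ∣ ≡ 1ℚ
∣q-p∣≡1 (inj₁ p≡0) (inj₁ q≡0) q-p≢0 = contradiction (cong₂ _-_ q≡0 p≡0) q-p≢0
∣q-p∣≡1 (inj₁ p≡0) (inj₂ q≡1) q-p≢0 = cong ∣_∣ (cong₂ _-_ q≡1 p≡0)
∣q-p∣≡1 (inj₂ p≡1) (inj₁ q≡0) q-p≢0 = cong ∣_∣ (cong₂ _-_ q≡0 p≡1)
∣q-p∣≡1 (inj₂ p≡1) (inj₂ q≡1) q-p≢0 = contradiction (cong₂ _-_ q≡1 p≡1) q-p≢0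

-- Finite sums, linear functionals and search over Fin

Σℚ≡sum : ∀ k (f : Vecℚ k) → Σℚ k f ≡ sum f
Σℚ≡sum zero    f = refl
Σℚ≡sum (suc k) f = cong (λ s → f zero + s) (Σℚ≡sum k (f ∘ suc))

Σℚ-cong : ∀ k {f g : Vecℚ k} → f ≗ g → Σℚ k f ≡ Σℚ k g
Σℚ-cong k {f} {g} f≗g = trans (Σℚ≡sum k f) (trans (sum-cong-≗ f≗g) (sym (Σℚ≡sum k g)))

Σℚ-distrib-+ : ∀ k (f g : Vecℚ k) → Σℚ k (λ i → f i + g i) ≡ Σℚ k f + Σℚ k g
Σℚ-distrib-+ k f g = trans (Σℚ≡sum k _)
  (trans (∑-distrib-+ f g) (sym (cong₂ _+_ (Σℚ≡sum k f) (Σℚ≡sum k g))))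

*-distribˡ-Σℚ : ∀ k a (f : Vecℚ k) → Σℚ k (λ i → a * f i) ≡ a * Σℚ k f
*-distribˡ-Σℚ k a f = trans (Σℚ≡sum k _) (sym (trans (cong (a *_) (Σℚ≡sum k f)) (*-distribˡ-sum a f)))

Σℚ-zero : ∀ k → Σℚ k (λ _ → 0ℚ) ≡ 0ℚ
Σℚ-zero zero    = refl
Σℚ-zero (suc k) = trans (+-identityˡ _) (Σℚ-zero k)

1+ι : ∀ k → 1ℚ + ι (+ k) ≡ ι (+ suc k)
1+ι zero    = refl
1+ι (suc k) = begin
  1ℚ + ι (+ suc k)           ≡⟨ cong (λ s → 1ℚ + s) (normalize-coprime coprime) ⟩
  1ℚ + mkℚ (+ suc k) 0 coprime ≡⟨ cong (λ m → + suc m ℚ./ 1) (ℕ.*-identityʳ (suc k)) ⟩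
  ι (+ suc (suc k))          ∎
  where
  open ≡-Reasoning
  coprime = Coprime.sym (1-coprimeTo (suc k))

Σℚ-one : ∀ k → Σℚ k (λ _ → 1ℚ) ≡ ι (+ k)
Σℚ-one zero    = refl
Σℚ-one (suc k) = trans (cong (λ s → 1ℚ + s) (Σℚ-one k)) (1+ι k)

Σℚ-mono-≤ : ∀ k {f g : Vecℚ k} → (∀ i → f i ≤ g i) → Σℚ k f ≤ Σℚ k g
Σℚ-mono-≤ zero    f≤g = ≤-refl
Σℚ-mono-≤ (suc k) f≤g = +-mono-≤ (f≤g zero) (Σℚ-mono-≤ k (f≤g ∘ suc))

Σℚ-nonNeg : ∀ k {f : Vecℚ k} → (∀ i → 0ℚ ≤ f i) → 0ℚ ≤ Σℚ k f
Σℚ-nonNeg k {f} 0≤f = subst (_≤ Σℚ k f) (Σℚ-zero k) (Σℚ-mono-≤ k 0≤f)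

term≤Σℚ : ∀ k {f : Vecℚ k} → (∀ i → 0ℚ ≤ f i) → ∀ i → f i ≤ Σℚ k f
term≤Σℚ (suc k) {f} 0≤f zero =
  subst (_≤ Σℚ (suc k) f) (+-identityʳ (f zero)) (+-monoʳ-≤ (f zero) (Σℚ-nonNeg k (0≤f ∘ suc)))
term≤Σℚ (suc k) {f} 0≤f (suc i) =
  subst (_≤ Σℚ (suc k) f) (+-identityˡ (f (suc i))) (+-mono-≤ (0≤f zero) (term≤Σℚ k (0≤f ∘ suc) i))

0<norm1 : ∀ {k} {v : Vecℚ k} i → v i ≢ 0ℚ → 0ℚ < norm1 v
0<norm1 {k} {v} i vi≢0 = <-≤-trans
  (≤∧≢⇒< (0≤∣p∣ (v i)) (λ 0≡∣vi∣ → vi≢0 (∣p∣≡0⇒p≡0 (v i) (sym 0≡∣vi∣))))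
  (term≤Σℚ k (λ j → 0≤∣p∣ (v j)) i)

Σℚ≡0⇒≡0 : ∀ k {f : Vecℚ k} → (∀ i → 0ℚ ≤ f i) → Σℚ k f ≡ 0ℚ → ∀ i → f i ≡ 0ℚ
Σℚ≡0⇒≡0 k 0≤f Σ≡0 i = ≤-antisym (subst (_ ≤_) Σ≡0 (term≤Σℚ k 0≤f i)) (0≤f i)

ιᵥ : ∀ {k} → (Fin k → ℤ) → Vecℚ k
ιᵥ v i = ι (v i)

_-ᵥ_ : ∀ {k} → Vecℚ k → Vecℚ k → Vecℚ k
(u -ᵥ v) i = u i - v i

step-difference : ∀ {k} (x : Vecℚ k) t h → (x +ᵥ (t ∙ᵥ h)) -ᵥ x ≗ t ∙ᵥ h
step-difference x t h i = solve 3 (λ x t h → (x :+ t :* h) :- x := t :* h) refl (x i) t (h i)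

InOpenSegment : ∀ {k} → Vecℚ k → Vecℚ k → ℚ → Vecℚ k → Set
InOpenSegment y z λ' p = 0ℚ < λ' × λ' < 1ℚ × (∀ i → p i ≡ λ' * y i + (1ℚ - λ') * z i)

InOpenSegment-sym : ∀ {k} {y z : Vecℚ k} {λ' p} → InOpenSegment y z λ' p → InOpenSegment z y (1ℚ - λ') p
InOpenSegment-sym {y = y} {z} {λ'} (0<λ , λ<1 , p≡) =
  p<q⇒0<q-p λ<1 ,
  0<q-p⇒p<q (subst (0ℚ <_) (solve 1 (λ l → l := con 1ℚ :- (con 1ℚ :- l)) refl λ') 0<λ) ,
  λ i → trans (p≡ i) (solve 3 (λ l y z → l :* y :+ (con 1ℚ :- l) :* z
                                     := (con 1ℚ :- l) :* z :+ (con 1ℚ :- (con 1ℚ :- l)) :* y) refl λ' (y i) (z i))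

record IsLinear {k} (F : Vecℚ k → ℚ) : Set where
  field
    resp-≗ : ∀ {u v} → u ≗ v → F u ≡ F v
    linear : ∀ a b u v → F (λ i → a * u i + b * v i) ≡ a * F u + b * F v

  scale : ∀ t v → F (t ∙ᵥ v) ≡ t * F v
  scale t v = begin
    F (t ∙ᵥ v)                       ≡⟨ resp-≗ (λ i → solve 2 (λ t v → t :* v := t :* v :+ con 0ℚ :* v) refl t (v i)) ⟩
    F (λ i → t * v i + 0ℚ * v i)     ≡⟨ linear t 0ℚ v v ⟩
    t * F v + 0ℚ * F v               ≡⟨ solve 2 (λ t w → t :* w :+ con 0ℚ :* w := t :* w) refl t (F v) ⟩
    t * F v                          ∎
    where open ≡-Reasoning

  axpy : ∀ t u v → F (u +ᵥ (t ∙ᵥ v)) ≡ F u + t * F v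
  axpy t u v = begin
    F (u +ᵥ (t ∙ᵥ v))                ≡⟨ resp-≗ (λ i → cong (_+ t * v i) (sym (*-identityˡ (u i)))) ⟩
    F (λ i → 1ℚ * u i + t * v i)     ≡⟨ linear 1ℚ t u v ⟩
    1ℚ * F u + t * F v               ≡⟨ cong (_+ t * F v) (*-identityˡ (F u)) ⟩
    F u + t * F v                    ∎
    where open ≡-Reasoning

  additive : ∀ u v → F (u +ᵥ v) ≡ F u + F v
  additive u v = begin
    F (u +ᵥ v)             ≡⟨ resp-≗ (λ i → cong (λ s → u i + s) (*-identityˡ (v i))) ⟨
    F (u +ᵥ (1ℚ ∙ᵥ v))     ≡⟨ axpy 1ℚ u v ⟩
    F u + 1ℚ * F v         ≡⟨ cong (λ s → F u + s) (*-identityˡ (F v)) ⟩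
    F u + F v              ∎
    where open ≡-Reasoning

  difference : ∀ u v → F (u -ᵥ v) ≡ F u - F v
  difference u v = begin
    F (u -ᵥ v)                       ≡⟨ resp-≗ (λ i → solve 2 (λ u v → u :- v := u :+ con (- 1ℚ) :* v) refl (u i) (v i)) ⟩
    F (u +ᵥ ((- 1ℚ) ∙ᵥ v))           ≡⟨ axpy (- 1ℚ) u v ⟩
    F u + (- 1ℚ) * F v               ≡⟨ solve 2 (λ a b → a :+ con (- 1ℚ) :* b := a :- b) refl (F u) (F v) ⟩
    F u - F v                        ∎
    where open ≡-Reasoning

  vanishes : ∀ {v} → v ≗ zeroV → F v ≡ 0ℚ
  vanishes {v} v≗0 = begin
    F v              ≡⟨ resp-≗ (λ i → trans (v≗0 i) (sym (*-zeroˡ (v i)))) ⟩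
    F (0ℚ ∙ᵥ v)      ≡⟨ scale 0ℚ v ⟩
    0ℚ * F v         ≡⟨ *-zeroˡ (F v) ⟩
    0ℚ               ∎
    where open ≡-Reasoning

inner : ∀ {k} → Vecℚ k → Vecℚ k → ℚ
inner {k} f v = Σℚ k (λ j → f j * v j)

inner-comm : ∀ {k} (f v : Vecℚ k) → inner f v ≡ inner v f
inner-comm {k} f v = Σℚ-cong k (λ j → *-comm (f j) (v j))

inner-linear : ∀ {k} (f : Vecℚ k) → IsLinear (inner f)
inner-linear {k} f = record { resp-≗ = respects ; linear = lin }
  where
  respects : ∀ {u v} → u ≗ v → inner f u ≡ inner f v
  respects u≗v = Σℚ-cong k (λ j → cong (f j *_) (u≗v j))
  lin : ∀ a b u v → inner f (λ i → a * u i + b * v i) ≡ a * inner f u + b * inner f v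
  lin a b u v = begin
    Σℚ k (λ j → f j * (a * u j + b * v j))
      ≡⟨ Σℚ-cong k (λ j → solve 5 (λ f a b u v → f :* (a :* u :+ b :* v) := a :* (f :* u) :+ b :* (f :* v))
                                  refl (f j) a b (u j) (v j)) ⟩
    Σℚ k (λ j → a * (f j * u j) + b * (f j * v j))
      ≡⟨ Σℚ-distrib-+ k _ _ ⟩
    Σℚ k (λ j → a * (f j * u j)) + Σℚ k (λ j → b * (f j * v j))
      ≡⟨ cong₂ _+_ (*-distribˡ-Σℚ k a _) (*-distribˡ-Σℚ k b _) ⟩
    a * inner f u + b * inner f v ∎
    where open ≡-Reasoning

inner-linearˡ : ∀ {k} a b (f g v : Vecℚ k) → inner (λ j → a * f j + b * g j) v ≡ a * inner f v + b * inner g v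
inner-linearˡ a b f g v = begin
  inner (λ j → a * f j + b * g j) v   ≡⟨ inner-comm _ v ⟩
  inner v (λ j → a * f j + b * g j)   ≡⟨ IsLinear.linear (inner-linear v) a b f g ⟩
  a * inner v f + b * inner v g       ≡⟨ cong₂ (λ s t → a * s + b * t) (inner-comm v f) (inner-comm v g) ⟩
  a * inner f v + b * inner g v       ∎
  where open ≡-Reasoning

module Inner {k} (f : Vecℚ k) = IsLinear (inner-linear f)

count¬ : ∀ {k} {Q : Fin k → Set} → Decidable Q → ℕ
count¬ {zero}  Q? = zero
count¬ {suc k} Q? with Q? zero
... | yes _ = count¬ (Q? ∘ suc)
... | no  _ = suc (count¬ (Q? ∘ suc))

count¬-antimono : ∀ {k} {Q Q' : Fin k → Set} (Q? : Decidable Q) (Q'? : Decidable Q') →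
  (∀ i → Q i → Q' i) → count¬ Q'? ℕ.≤ count¬ Q?
count¬-antimono {zero}  Q? Q'? Q⇒Q' = ℕ.z≤n
count¬-antimono {suc k} Q? Q'? Q⇒Q' with Q? zero | Q'? zero
... | yes _  | yes _   = count¬-antimono (Q? ∘ suc) (Q'? ∘ suc) (Q⇒Q' ∘ suc)
... | yes q  | no ¬q'  = contradiction (Q⇒Q' zero q) ¬q'
... | no  _  | yes _   = ℕ.m≤n⇒m≤1+n (count¬-antimono (Q? ∘ suc) (Q'? ∘ suc) (Q⇒Q' ∘ suc))
... | no  _  | no  _   = ℕ.s≤s (count¬-antimono (Q? ∘ suc) (Q'? ∘ suc) (Q⇒Q' ∘ suc))

count¬-strict : ∀ {k} {Q Q' : Fin k → Set} (Q? : Decidable Q) (Q'? : Decidable Q') →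
  (∀ i → Q i → Q' i) → ∀ j → Q' j → ¬ Q j → count¬ Q'? ℕ.< count¬ Q?
count¬-strict {suc k} Q? Q'? Q⇒Q' zero q'j ¬qj with Q? zero | Q'? zero
... | yes q | _      = contradiction q ¬qj
... | no _  | yes _  = ℕ.s≤s (count¬-antimono (Q? ∘ suc) (Q'? ∘ suc) (Q⇒Q' ∘ suc))
... | no _  | no ¬q' = contradiction q'j ¬q'
count¬-strict {suc k} Q? Q'? Q⇒Q' (suc j) q'j ¬qj with Q? zero | Q'? zero
... | yes _ | yes _  = count¬-strict (Q? ∘ suc) (Q'? ∘ suc) (Q⇒Q' ∘ suc) j q'j ¬qj
... | yes q | no ¬q' = contradiction (Q⇒Q' zero q) ¬q'
... | no _  | yes _  = ℕ.m≤n⇒m≤1+n (count¬-strict (Q? ∘ suc) (Q'? ∘ suc) (Q⇒Q' ∘ suc) j q'j ¬qj)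
... | no _  | no _   = ℕ.s≤s (count¬-strict (Q? ∘ suc) (Q'? ∘ suc) (Q⇒Q' ∘ suc) j q'j ¬qj)

argmin : ∀ {k} {P : Fin k → Set} → Decidable P → (f : ∀ i → .(P i) → ℚ) → ∃ P →
  ∃ λ j → Σ (P j) λ pj → ∀ i (pi : P i) → f j pj ≤ f i pi
argmin {suc k} {P} P? f (i , pi) with any? (P? ∘ suc)
argmin {suc k} {P} P? f (zero , p0)  | no none = zero , p0 , λ
  { zero _ → ≤-refl ; (suc i) pi → contradiction (i , pi) none }
argmin {suc k} {P} P? f (suc i , pi) | no none = contradiction (i , pi) none
argmin {suc k} {P} P? f (i , pi)     | yes some with argmin (P? ∘ suc) (f ∘ suc) some | P? zero
... | j , pj , min | no ¬p0 = suc j , pj , λ { zero p0 → contradiction p0 ¬p0 ; (suc i) pi → min i pi }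
... | j , pj , min | yes p0 with f zero p0 ≤? f (suc j) pj
...   | yes f0≤ = zero , p0 , λ { zero _ → ≤-refl ; (suc i) pi → ≤-trans f0≤ (min i pi) }
...   | no f0≰ = suc j , pj , λ { zero _ → <⇒≤ (≰⇒> f0≰) ; (suc i) pi → min i pi }

-- Polyhedra

module Polyhedron {n : ℕ} (L : LP n) where
  open LP L

  rowA : Fin mA → Vecℚ n
  rowA i j = ι (A i j)

  rowB : Fin mB → Vecℚ n
  rowB j k = ι (B j k)

  Tight : Vecℚ n → Fin mB → Set
  Tight p j = (B · p) j ≡ ι (d j)

  tight? : ∀ p → Decidable (Tight p)
  tight? p j = (B · p) j ≟ ι (d j)

  #nonTight : Vecℚ n → ℕ
  #nonTight p = count¬ (tight? p)

  Feasible-resp-≗ : ∀ {u v} → u ≗ v → Feasible L u → Feasible L v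
  Feasible-resp-≗ u≗v (Au≡b , Bu≤d) =
    (λ i → trans (sym (Inner.resp-≗ (rowA i) u≗v)) (Au≡b i)) ,
    (λ j → subst (_≤ ι (d j)) (Inner.resp-≗ (rowB j) u≗v) (Bu≤d j))

  Feasible-convex : ∀ {y z λ'} → Feasible L y → Feasible L z → 0ℚ ≤ λ' → λ' ≤ 1ℚ →
    Feasible L (λ i → λ' * y i + (1ℚ - λ') * z i)
  Feasible-convex {y} {z} {λ'} (Ay≡b , By≤d) (Az≡b , Bz≤d) 0≤λ λ≤1 = Aeq , Ble
    where
    average : ∀ r → λ' * r + (1ℚ - λ') * r ≡ r
    average r = solve 2 (λ l r → l :* r :+ (con 1ℚ :- l) :* r := r) refl λ' r
    Aeq : ∀ i → (A · (λ i → λ' * y i + (1ℚ - λ') * z i)) i ≡ ι (b i)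
    Aeq i = trans (Inner.linear (rowA i) λ' (1ℚ - λ') y z)
      (trans (cong₂ (λ s t → λ' * s + (1ℚ - λ') * t) (Ay≡b i) (Az≡b i)) (average (ι (b i))))
    Ble : ∀ j → (B · (λ i → λ' * y i + (1ℚ - λ') * z i)) j ≤ ι (d j)
    Ble j = subst₂ _≤_ (sym (Inner.linear (rowB j) λ' (1ℚ - λ') y z)) (average (ι (d j)))
      (+-mono-≤ (*-monoˡ-≤-0≤ λ' 0≤λ (By≤d j)) (*-monoˡ-≤-0≤ (1ℚ - λ') (p≤q⇒0≤q-p λ≤1) (Bz≤d j)))

  difference∈kerA : ∀ {y z} → Feasible L y → Feasible L z → InKerA L (y -ᵥ z)
  difference∈kerA {y} {z} (Ay≡b , _) (Az≡b , _) i =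
    trans (Inner.difference (rowA i) y z) (trans (cong₂ _-_ (Ay≡b i) (Az≡b i)) (+-inverseʳ (ι (b i))))

  difference-tight : ∀ {y z} j → Tight y j → Tight z j → (B · (y -ᵥ z)) j ≡ 0ℚ
  difference-tight {y} {z} j y-tight z-tight =
    trans (Inner.difference (rowB j) y z) (trans (cong₂ _-_ y-tight z-tight) (+-inverseʳ (ι (d j))))

  Feasible-step : ∀ {p w t} → Feasible L p → InKerA L w → 0ℚ ≤ t →
    (∀ j → 0ℚ < (B · w) j → t * (B · w) j ≤ ι (d j) - (B · p) j) →
    Feasible L (p +ᵥ (t ∙ᵥ w))
  Feasible-step {p} {w} {t} (Ap≡b , Bp≤d) Aw≡0 0≤t room = Aeq , Ble
    where
    Aeq : ∀ i → (A · (p +ᵥ (t ∙ᵥ w))) i ≡ ι (b i)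
    Aeq i = begin
      (A · (p +ᵥ (t ∙ᵥ w))) i      ≡⟨ Inner.axpy (rowA i) t p w ⟩
      (A · p) i + t * (A · w) i    ≡⟨ cong₂ (λ s r → s + t * r) (Ap≡b i) (Aw≡0 i) ⟩
      ι (b i) + t * 0ℚ             ≡⟨ solve 2 (λ s t → s :+ t :* con 0ℚ := s) refl (ι (b i)) t ⟩
      ι (b i)                      ∎
      where open ≡-Reasoning
    stays-below : ∀ j → (B · p) j + t * (B · w) j ≤ ι (d j)
    stays-below j with 0ℚ <? (B · w) j
    ... | yes 0<Bw = ≤-by-difference
      (solve 4 (λ D P T W → (D :- P) :- T :* W := D :- (P :+ T :* W)) refl (ι (d j)) ((B · p) j) t ((B · w) j))
      (room j 0<Bw)
    ... | no 0≮Bw = ≤-trans (+-monoʳ-≤ ((B · p) j) tBw≤0) (subst (_≤ ι (d j)) (sym (+-identityʳ _)) (Bp≤d j))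
      where
      tBw≤0 : t * (B · w) j ≤ 0ℚ
      tBw≤0 = subst (t * (B · w) j ≤_) (*-zeroʳ t) (*-monoˡ-≤-0≤ t 0≤t (≮⇒≥ 0≮Bw))
    Ble : ∀ j → (B · (p +ᵥ (t ∙ᵥ w))) j ≤ ι (d j)
    Ble j = subst (_≤ ι (d j)) (sym (Inner.axpy (rowB j) t p w)) (stays-below j)

  bounded⇒recession-trivial : Bounded L → ∀ {p w} → Feasible L p → InKerA L w → (∀ j → (B · w) j ≤ 0ℚ) →
    w ≗ zeroV
  bounded⇒recession-trivial (M , bound) {p} {w} p∈P Aw≡0 Bw≤0 k with w k ≟ 0ℚ
  ... | yes wk≡0 = wk≡0
  ... | no wk≢0 = ⊥-elim (<-irrefl refl K<K)
    where
    a = ∣ w k ∣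
    0<a : 0ℚ < a
    0<a = ≤∧≢⇒< (0≤∣p∣ (w k)) (λ 0≡a → wk≢0 (∣p∣≡0⇒p≡0 (w k) (sym 0≡a)))
    K = M + ∣ p k ∣ + 1ℚ
    0<K : 0ℚ < K
    0<K = +-mono-≤-< (+-mono-≤ (≤-trans (0≤∣p∣ (p k)) (bound p p∈P k)) (0≤∣p∣ (p k))) (positive⁻¹ 1ℚ)
    t = K * 1/pos a 0<a
    q = p +ᵥ (t ∙ᵥ w)
    q∈P : Feasible L q
    q∈P = Feasible-step p∈P Aw≡0 (*-nonNeg (<⇒≤ 0<K) (<⇒≤ (1/pos-pos a 0<a)))
      (λ j 0<Bw → ⊥-elim (<-irrefl refl (<-≤-trans 0<Bw (Bw≤0 j))))
    ∣twk∣≡K : ∣ t * w k ∣ ≡ K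
    ∣twk∣≡K = begin
      ∣ t * w k ∣                ≡⟨ ∣p*q∣≡∣p∣*∣q∣ t (w k) ⟩
      ∣ t ∣ * a                  ≡⟨ cong (_* a) (0≤p⇒∣p∣≡p (*-nonNeg (<⇒≤ 0<K) (<⇒≤ (1/pos-pos a 0<a)))) ⟩
      K * 1/pos a 0<a * a        ≡⟨ solve 3 (λ K i a → K :* i :* a := K :* (a :* i)) refl K (1/pos a 0<a) a ⟩
      K * (a * 1/pos a 0<a)      ≡⟨ cong (K *_) (*-1/pos a 0<a) ⟩
      K * 1ℚ                     ≡⟨ *-identityʳ K ⟩
      K                          ∎
      where open ≡-Reasoning
    K<K : K < K
    K<K = begin-strict
      K                        ≡⟨ ∣twk∣≡K ⟨
      ∣ t * w k ∣               ≡⟨ cong ∣_∣ (solve 2 (λ P T → T := (P :+ T) :+ (:- P)) refl (p k) (t * w k)) ⟩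
      ∣ q k + - p k ∣           ≤⟨ ∣p+q∣≤∣p∣+∣q∣ (q k) (- p k) ⟩
      ∣ q k ∣ + ∣ - p k ∣       ≡⟨ cong (λ s → ∣ q k ∣ + s) (∣-p∣≡∣p∣ (p k)) ⟩
      ∣ q k ∣ + ∣ p k ∣         ≤⟨ +-monoˡ-≤ ∣ p k ∣ (bound q q∈P k) ⟩
      M + ∣ p k ∣               <⟨ subst (_< K) (+-identityʳ _) (+-monoʳ-< (M + ∣ p k ∣) (positive⁻¹ 1ℚ)) ⟩
      K                        ∎
      where open ≤-Reasoning

  record BlockedStep (p w : Vecℚ n) : Set where
    field
      step      : ℚ
      0≤step    : 0ℚ ≤ step
      feasible  : Feasible L (p +ᵥ (step ∙ᵥ w))
      blocking  : Fin mB
      ascending : 0ℚ < (B · w) blocking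
      blocked   : Tight (p +ᵥ (step ∙ᵥ w)) blocking
      0<step    : (∀ j → 0ℚ < (B · w) j → ¬ Tight p j) → 0ℚ < step

  module _ {p w : Vecℚ n} (p∈P : Feasible L p) (Aw≡0 : InKerA L w) where

    ratio : ∀ j → .(0ℚ < (B · w) j) → ℚ
    ratio j 0<Bw = (ι (d j) - (B · p) j) * 1/pos ((B · w) j) 0<Bw

    ratio-reaches : ∀ j .(0<Bw : 0ℚ < (B · w) j) → ratio j 0<Bw * (B · w) j ≡ ι (d j) - (B · p) j
    ratio-reaches j 0<Bw = begin
      slack * 1/pos Bw 0<Bw * Bw     ≡⟨ solve 3 (λ s i w → s :* i :* w := s :* (w :* i)) refl slack (1/pos Bw 0<Bw) Bw ⟩
      slack * (Bw * 1/pos Bw 0<Bw)   ≡⟨ cong (slack *_) (*-1/pos Bw 0<Bw) ⟩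
      slack * 1ℚ                     ≡⟨ *-identityʳ slack ⟩
      slack                          ∎
      where
      open ≡-Reasoning
      slack = ι (d j) - (B · p) j
      Bw = (B · w) j

    step-to-minimal-ratio : ∀ j (0<Bwj : 0ℚ < (B · w) j) →
      (∀ i (0<Bwi : 0ℚ < (B · w) i) → ratio j 0<Bwj ≤ ratio i 0<Bwi) → BlockedStep p w
    step-to-minimal-ratio j 0<Bwj minimal = record
      { step = t ; 0≤step = 0≤t ; feasible = Feasible-step p∈P Aw≡0 0≤t room
      ; blocking = j ; ascending = 0<Bwj ; blocked = blocked ; 0<step = 0<t }
      where
      t = ratio j 0<Bwj
      0≤t : 0ℚ ≤ t
      0≤t = *-nonNeg (p≤q⇒0≤q-p (proj₂ p∈P j)) (<⇒≤ (1/pos-pos _ 0<Bwj))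
      room : ∀ i → 0ℚ < (B · w) i → t * (B · w) i ≤ ι (d i) - (B · p) i
      room i 0<Bwi = subst (t * (B · w) i ≤_) (ratio-reaches i 0<Bwi)
        (subst₂ _≤_ (*-comm ((B · w) i) t) (*-comm ((B · w) i) (ratio i 0<Bwi))
          (*-monoˡ-≤-0≤ ((B · w) i) (<⇒≤ 0<Bwi) (minimal i 0<Bwi)))
      blocked : Tight (p +ᵥ (t ∙ᵥ w)) j
      blocked = begin
        (B · (p +ᵥ (t ∙ᵥ w))) j              ≡⟨ Inner.axpy (rowB j) t p w ⟩
        (B · p) j + t * (B · w) j            ≡⟨ cong (λ s → (B · p) j + s) (ratio-reaches j 0<Bwj) ⟩
        (B · p) j + (ι (d j) - (B · p) j)    ≡⟨ solve 2 (λ P D → P :+ (D :- P) := D) refl ((B · p) j) (ι (d j)) ⟩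
        ι (d j)                              ∎
        where open ≡-Reasoning
      0<t : (∀ i → 0ℚ < (B · w) i → ¬ Tight p i) → 0ℚ < t
      0<t nothing-blocks = *-pos (p<q⇒0<q-p (≤∧≢⇒< (proj₂ p∈P j) (nothing-blocks j 0<Bwj))) (1/pos-pos _ 0<Bwj)

    ratio-test : (∃ λ j → 0ℚ < (B · w) j) → BlockedStep p w
    ratio-test ascent with argmin (λ j → 0ℚ <? (B · w) j) ratio ascent
    ... | j , 0<Bwj , minimal = step-to-minimal-ratio j 0<Bwj minimal

  tight-at-ends : ∀ {p y z λ'} → Feasible L y → Feasible L z → InOpenSegment y z λ' p →
    ∀ j → Tight p j → Tight y j
  tight-at-ends {p} {y} {z} {λ'} (_ , By≤d) (_ , Bz≤d) (0<λ , λ<1 , p≡) j p-tight =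
    q-p≡0⇒p≡q slack-y≡0
    where
    D = ι (d j)
    Y = (B · y) j
    Z = (B · z) j
    weighted-slack≡0 : λ' * (D - Y) + (1ℚ - λ') * (D - Z) ≡ 0ℚ
    weighted-slack≡0 = begin
      λ' * (D - Y) + (1ℚ - λ') * (D - Z)   ≡⟨ solve 4 (λ l D Y Z → l :* (D :- Y) :+ (con 1ℚ :- l) :* (D :- Z)
                                                            := D :- (l :* Y :+ (con 1ℚ :- l) :* Z)) refl λ' D Y Z ⟩
      D - (λ' * Y + (1ℚ - λ') * Z)         ≡⟨ cong (λ s → D - s) (Inner.linear (rowB j) λ' (1ℚ - λ') y z) ⟨
      D - (B · p') j                        ≡⟨ cong (λ s → D - s) (Inner.resp-≗ (rowB j) p≡) ⟨
      D - (B · p) j                         ≡⟨ cong (λ s → D - s) p-tight ⟩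
      D - D                                 ≡⟨ +-inverseʳ D ⟩
      0ℚ                                    ∎
      where
      open ≡-Reasoning
      p' = λ i → λ' * y i + (1ℚ - λ') * z i
    slack-y≡0 : D - Y ≡ 0ℚ
    slack-y≡0 = *-cancelˡ-≡0-pos 0<λ (nonNeg+nonNeg≡0⇒≡0
      (*-nonNeg (<⇒≤ 0<λ) (p≤q⇒0≤q-p (By≤d j))) (*-nonNeg (p≤q⇒0≤q-p (<⇒≤ λ<1)) (p≤q⇒0≤q-p (Bz≤d j)))
      weighted-slack≡0)

  module _ (P-bounded : Bounded L) {F : Vecℚ n → ℚ} (F-linear : IsLinear F) where
    open IsLinear F-linear

    -- A point p inside a segment [y, z] with F y ≤ F z can move along y − z without increasing F:
    -- the inequalities tight at p are tight at y and z, so they stay tight, and boundedness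
    -- forces the ratio test to make one more inequality tight.
    descend : ∀ {p y z λ'} → Feasible L p → Feasible L y → Feasible L z → InOpenSegment y z λ' p →
      F y ≤ F z → ∀ k → y k ≢ z k →
      ∃ λ p' → Feasible L p' × #nonTight p' ℕ.< #nonTight p × F p' ≤ F p
    descend {p} {y} {z} p∈P y∈P z∈P seg Fy≤Fz k yk≢zk with any? (λ j → 0ℚ <? (B · (y -ᵥ z)) j)
    ... | no no-ascent = contradiction (sym (q-p≡0⇒p≡q recession-trivial)) yk≢zk
      where
      recession-trivial = bounded⇒recession-trivial P-bounded p∈P (difference∈kerA y∈P z∈P)
        (λ j → ≮⇒≥ (λ 0<Bw → no-ascent (j , 0<Bw))) k
    ... | yes ascent = p' , feasible , fewer-nonTight , Fp'≤Fp
      where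
      w = y -ᵥ z
      open BlockedStep (ratio-test p∈P (difference∈kerA y∈P z∈P) ascent)
      p' = p +ᵥ (step ∙ᵥ w)
      flat-on-tight : ∀ j → Tight p j → (B · w) j ≡ 0ℚ
      flat-on-tight j p-tight = difference-tight j (tight-at-ends y∈P z∈P seg j p-tight)
                                                   (tight-at-ends z∈P y∈P (InOpenSegment-sym seg) j p-tight)
      stays-tight : ∀ j → Tight p j → Tight p' j
      stays-tight j p-tight = begin
        (B · p') j                       ≡⟨ Inner.axpy (rowB j) step p w ⟩
        (B · p) j + step * (B · w) j     ≡⟨ cong₂ (λ s r → s + step * r) p-tight (flat-on-tight j p-tight) ⟩
        ι (d j) + step * 0ℚ              ≡⟨ solve 2 (λ D t → D :+ t :* con 0ℚ := D) refl (ι (d j)) step ⟩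
        ι (d j)                          ∎
        where open ≡-Reasoning
      fewer-nonTight : #nonTight p' ℕ.< #nonTight p
      fewer-nonTight = count¬-strict (tight? p) (tight? p') stays-tight blocking blocked
        (λ p-tight → <⇒≢ ascending (sym (flat-on-tight blocking p-tight)))
      Fw≤0 : F w ≤ 0ℚ
      Fw≤0 = subst (_≤ 0ℚ) (sym (difference y z))
        (≤-by-difference (solve 2 (λ a b → b :- a := con 0ℚ :- (a :- b)) refl (F y) (F z)) Fy≤Fz)
      Fp'≤Fp : F p' ≤ F p
      Fp'≤Fp = begin
        F p'                 ≡⟨ axpy step p w ⟩
        F p + step * F w     ≤⟨ +-monoʳ-≤ (F p) (subst (step * F w ≤_) (*-zeroʳ step)
                                                   (*-monoˡ-≤-0≤ step 0≤step Fw≤0)) ⟩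
        F p + 0ℚ             ≡⟨ +-identityʳ (F p) ⟩
        F p                  ∎
        where open ≤-Reasoning

    vertex-bound : ∀ m → (∀ v → ExtremePoint L v → m ≤ F v) → ∀ p → Feasible L p → m ≤ F p
    vertex-bound m m≤vertex =
      All.wfRec (On.wellFounded #nonTight <-wellFounded) _ (λ p → Feasible L p → m ≤ F p) bound-at
      where
      bound-at : ∀ p → (∀ {p'} → #nonTight p' ℕ.< #nonTight p → Feasible L p' → m ≤ F p') →
        Feasible L p → m ≤ F p
      bound-at p IH p∈P with m ≤? F p
      ... | yes m≤Fp = m≤Fp
      ... | no m≰Fp = contradiction (m≤vertex p (p∈P , extreme)) m≰Fp
        where
        refute : (∃ λ p' → Feasible L p' × #nonTight p' ℕ.< #nonTight p × F p' ≤ F p) → ⊥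
        refute (p' , p'∈P , fewer , Fp'≤Fp) = m≰Fp (≤-trans (IH fewer p'∈P) Fp'≤Fp)
        extreme : ∀ y z λ' → Feasible L y → Feasible L z → 0ℚ < λ' → λ' < 1ℚ →
          (∀ i → p i ≡ λ' * y i + (1ℚ - λ') * z i) → ∀ i → y i ≡ z i
        extreme y z λ' y∈P z∈P 0<λ λ<1 p≡ with all? (λ i → y i ≟ z i)
        ... | yes y≗z = y≗z
        ... | no y≉z with ¬∀⟶∃¬ n _ (λ i → y i ≟ z i) y≉z | F y ≤? F z
        ...   | k , yk≢zk | yes Fy≤Fz = ⊥-elim (refute (descend p∈P y∈P z∈P (0<λ , λ<1 , p≡) Fy≤Fz k yk≢zk))
        ...   | k , yk≢zk | no Fy≰Fz = ⊥-elim (refute (descend p∈P z∈P y∈P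
                  (InOpenSegment-sym (0<λ , λ<1 , p≡)) (<⇒≤ (≰⇒> Fy≰Fz)) k (yk≢zk ∘ sym)))

  improvement-≡ : ∀ x β h → improvement L x β h ≡ - (β * dot c h)
  improvement-≡ x β h = trans (cong (λ s → dot c x - s) (Inner.axpy (ιᵥ c) β x h))
    (solve 2 (λ X Y → X :- (X :+ Y) := :- Y) refl (dot c x) (β * dot c h))

  dot-step : ∀ x t h → dot c ((x +ᵥ (t ∙ᵥ h)) -ᵥ x) ≡ t * dot c h
  dot-step x t h = trans (Inner.resp-≗ (ιᵥ c) (step-difference x t h)) (Inner.scale (ιᵥ c) t h)

  -- A greatest-improvement direction is descending: otherwise half the step would improve more.
  greatest-improvement-descends : ∀ {x α* g*} → Feasible L x → GreatestImprovement L x α* g* →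
    dot c (ιᵥ g*) ≤ 0ℚ
  greatest-improvement-descends {x} {α*} {g*} x∈P (g*∈C , 0<α* , step∈P , greatest) =
    *-cancelˡ-≤-0< h 0<h (≤-by-difference
      (solve 2 (λ a C → :- (a :* C) :- :- ((a :* con ½) :* C) := (a :* con ½) :* con 0ℚ :- (a :* con ½) :* C)
             refl α* (dot c (ιᵥ g*)))
      (subst₂ _≤_ (improvement-≡ x h (ιᵥ g*)) (improvement-≡ x α* (ιᵥ g*)) (greatest g* h g*∈C 0<h half-step∈P)))
    where
    h = α* * ½
    0<h : 0ℚ < h
    0<h = *-pos 0<α* (positive⁻¹ ½)
    half-step∈P : Feasible L (x +ᵥ (h ∙ᵥ ιᵥ g*))
    half-step∈P = Feasible-resp-≗
      (λ i → solve 3 (λ x a g → con ½ :* x :+ (con 1ℚ :- con ½) :* (x :+ a :* g) := x :+ (a :* con ½) :* g)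
                     refl (x i) α* (ι (g* i)))
      (Feasible-convex x∈P step∈P (<⇒≤ (positive⁻¹ ½)) (<⇒≤ (0<q-p⇒p<q (positive⁻¹ (1ℚ - ½)))))

  greatest-step-descends : ∀ {x α* g*} → Feasible L x → GreatestImprovement L x α* g* →
    dot c ((x +ᵥ (α* ∙ᵥ ιᵥ g*)) -ᵥ x) ≤ 0ℚ
  greatest-step-descends {x} {α*} {g*} x∈P g*-greatest@(_ , 0<α* , _) =
    subst (_≤ 0ℚ) (sym (dot-step x α* (ιᵥ g*))) (subst (α* * dot c (ιᵥ g*) ≤_) (*-zeroʳ α*)
      (*-monoˡ-≤-0≤ α* (<⇒≤ 0<α*) (greatest-improvement-descends {g* = g*} x∈P g*-greatest)))

  greatest-step-nonzero : ∀ {x α* g*} → GreatestImprovement L x α* g* →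
    0ℚ < norm1 ((x +ᵥ (α* ∙ᵥ ιᵥ g*)) -ᵥ x)
  greatest-step-nonzero {x} {α*} {g*} (((_ , g*≢0 , _) , _) , 0<α* , _)
    with ¬∀⟶∃¬ n _ (λ i → ι (g* i) ≟ 0ℚ) g*≢0
  ... | k , g*k≢0 = 0<norm1 k (λ step≡0 →
    g*k≢0 (*-cancelˡ-≡0-pos 0<α* (trans (sym (step-difference x α* (ιᵥ g*) k)) step≡0)))

-- 0/1 polytopes and the feasible cone at a vertex

coordinate-linear : ∀ {n} (k : Fin n) → IsLinear (λ v → v k)
coordinate-linear k = record { resp-≗ = λ u≗v → u≗v k ; linear = λ a b u v → refl }

negated-coordinate-linear : ∀ {n} (k : Fin n) → IsLinear (λ v → - v k)
negated-coordinate-linear k = record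
  { resp-≗ = λ u≗v → cong -_ (u≗v k)
  ; linear = λ a b u v → solve 4 (λ a b u v → :- (a :* u :+ b :* v) := a :* (:- u) :+ b :* (:- v)) refl a b (u k) (v k)
  }

module ZeroOne {n : ℕ} (L : LP n) (P01 : ZeroOnePolytope L) where
  open Polyhedron L

  Feasible⇒0≤ : ∀ {p} → Feasible L p → ∀ k → 0ℚ ≤ p k
  Feasible⇒0≤ {p} p∈P k = vertex-bound (proj₁ P01) (coordinate-linear k) 0ℚ 0≤vertex p p∈P
    where
    0≤vertex : ∀ v → ExtremePoint L v → 0ℚ ≤ v k
    0≤vertex v v-extreme with proj₂ P01 v v-extreme k
    ... | inj₁ vk≡0 = ≤-reflexive (sym vk≡0)
    ... | inj₂ vk≡1 = subst (0ℚ ≤_) (sym vk≡1) (<⇒≤ (positive⁻¹ 1ℚ))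

  Feasible⇒≤1 : ∀ {p} → Feasible L p → ∀ k → p k ≤ 1ℚ
  Feasible⇒≤1 {p} p∈P k = ≤-by-difference (solve 1 (λ p → :- p :- :- con 1ℚ := con 1ℚ :- p) refl (p k))
    (vertex-bound (proj₁ P01) (negated-coordinate-linear k) (- 1ℚ) -1≤-vertex p p∈P)
    where
    -1≤-vertex : ∀ v → ExtremePoint L v → - 1ℚ ≤ - v k
    -1≤-vertex v v-extreme with proj₂ P01 v v-extreme k
    ... | inj₁ vk≡0 = subst (λ s → - 1ℚ ≤ - s) (sym vk≡0) (<⇒≤ (negative⁻¹ (- 1ℚ)))
    ... | inj₂ vk≡1 = subst (λ s → - 1ℚ ≤ - s) (sym vk≡1) ≤-refl

  norm1-difference≤n : ∀ {p q} → Feasible L p → Feasible L q → norm1 (p -ᵥ q) ≤ ι (+ n)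
  norm1-difference≤n {p} {q} p∈P q∈P = subst (norm1 (p -ᵥ q) ≤_) (Σℚ-one n)
    (Σℚ-mono-≤ n (λ k → ∣q-p∣≤1 (Feasible⇒0≤ q∈P k) (Feasible⇒≤1 q∈P k)
                                (Feasible⇒0≤ p∈P k) (Feasible⇒≤1 p∈P k)))

signOf : ∀ {a : ℚ} → (a ≡ 0ℚ) ⊎ (a ≡ 1ℚ) → ℤ
signOf (inj₁ _) = + 1
signOf (inj₂ _) = ℤ.-[1+ 0 ]

signOf-cases : ∀ {a} (a∈01 : (a ≡ 0ℚ) ⊎ (a ≡ 1ℚ)) →
  (a ≡ 0ℚ × ι (signOf a∈01) ≡ 1ℚ) ⊎ (a ≡ 1ℚ × ι (signOf a∈01) ≡ - 1ℚ)
signOf-cases (inj₁ a≡0) = inj₁ (a≡0 , refl)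
signOf-cases (inj₂ a≡1) = inj₂ (a≡1 , refl)

module VertexCone {n : ℕ} (L : LP n) (P01 : ZeroOnePolytope L) (x : Vecℚ n) (x-extreme : ExtremePoint L x) where
  open LP L
  open Polyhedron L
  open ZeroOne L P01

  x∈P : Feasible L x
  x∈P = proj₁ x-extreme

  sign : Fin n → ℤ
  sign k = signOf (proj₂ P01 x x-extreme k)

  signQ : Vecℚ n
  signQ k = ι (sign k)

  Cone : Vecℚ n → Set
  Cone = InCone L x

  Cone-difference : ∀ {p} → Feasible L p → Cone (p -ᵥ x)
  Cone-difference {p} p∈P = difference∈kerA p∈P x∈P , below
    where
    below : ∀ j → Tight x j → (B · (p -ᵥ x)) j ≤ 0ℚ
    below j x-tight = subst (_≤ 0ℚ) (sym (Inner.difference (rowB j) p x))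
      (≤-by-difference (solve 2 (λ X P → X :- P := con 0ℚ :- (P :- X)) refl ((B · x) j) ((B · p) j))
        (subst ((B · p) j ≤_) (sym x-tight) (proj₂ p∈P j)))

  Cone-scale : ∀ {u} a → 0ℚ ≤ a → Cone u → Cone (a ∙ᵥ u)
  Cone-scale {u} a 0≤a (Au≡0 , Bu≤0) =
    (λ i → trans (Inner.scale (rowA i) a u) (trans (cong (a *_) (Au≡0 i)) (*-zeroʳ a))) ,
    (λ j x-tight → subst (_≤ 0ℚ) (sym (Inner.scale (rowB j) a u))
      (subst (a * (B · u) j ≤_) (*-zeroʳ a) (*-monoˡ-≤-0≤ a 0≤a (Bu≤0 j x-tight))))

  Cone-small-step : ∀ {z} → Cone z → ∃ λ ε → 0ℚ < ε × Feasible L (x +ᵥ (ε ∙ᵥ z))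
  Cone-small-step {z} (Az≡0 , Bz≤0) with any? (λ j → 0ℚ <? (B · z) j)
  ... | no no-ascent = 1ℚ , positive⁻¹ 1ℚ ,
    Feasible-step x∈P Az≡0 (<⇒≤ (positive⁻¹ 1ℚ)) (λ j 0<Bz → contradiction (j , 0<Bz) no-ascent)
  ... | yes ascent = step , 0<step (λ j 0<Bz x-tight → <-irrefl refl (<-≤-trans 0<Bz (Bz≤0 j x-tight))) , feasible
    where open BlockedStep (ratio-test x∈P Az≡0 ascent)

  Cone-sign-aligned : ∀ {z} → Cone z → ∀ k → 0ℚ ≤ signQ k * z k
  Cone-sign-aligned {z} z∈C k with Cone-small-step z∈C | signOf-cases (proj₂ P01 x x-extreme k)
  ... | ε , 0<ε , step∈P | inj₁ (xk≡0 , sk≡1) = subst (0ℚ ≤_) (sym (trans (cong (_* z k) sk≡1) (*-identityˡ (z k))))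
    (*-cancelˡ-≤-0< ε 0<ε (begin
      ε * 0ℚ          ≡⟨ *-zeroʳ ε ⟩
      0ℚ              ≤⟨ Feasible⇒0≤ step∈P k ⟩
      x k + ε * z k   ≡⟨ cong (_+ ε * z k) xk≡0 ⟩
      0ℚ + ε * z k    ≡⟨ +-identityˡ (ε * z k) ⟩
      ε * z k         ∎))
    where open ≤-Reasoning
  ... | ε , 0<ε , step∈P | inj₂ (xk≡1 , sk≡-1) = subst (0ℚ ≤_) (sym (cong (_* z k) sk≡-1))
    (≤-by-difference (solve 1 (λ z → con 0ℚ :- z := con (- 1ℚ) :* z :- con 0ℚ) refl (z k))
      (*-cancelˡ-≤-0< ε 0<ε (begin
        ε * z k              ≡⟨ solve 2 (λ e z → e :* z := (con 1ℚ :+ e :* z) :- con 1ℚ) refl ε (z k) ⟩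
        (1ℚ + ε * z k) - 1ℚ  ≡⟨ cong (λ s → (s + ε * z k) - 1ℚ) xk≡1 ⟨
        (x k + ε * z k) - 1ℚ ≤⟨ +-monoˡ-≤ (- 1ℚ) (Feasible⇒≤1 step∈P k) ⟩
        1ℚ - 1ℚ              ≡⟨ solve 1 (λ e → con 1ℚ :- con 1ℚ := e :* con 0ℚ) refl ε ⟩
        ε * 0ℚ               ∎)))
    where open ≤-Reasoning

  Cone-∣∣ : ∀ {z} → Cone z → ∀ k → ∣ z k ∣ ≡ signQ k * z k
  Cone-∣∣ {z} z∈C k = begin
    ∣ z k ∣                ≡⟨ *-identityˡ ∣ z k ∣ ⟨
    1ℚ * ∣ z k ∣           ≡⟨ cong (_* ∣ z k ∣) ∣sign∣≡1 ⟨
    ∣ signQ k ∣ * ∣ z k ∣  ≡⟨ ∣p*q∣≡∣p∣*∣q∣ (signQ k) (z k) ⟨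
    ∣ signQ k * z k ∣      ≡⟨ 0≤p⇒∣p∣≡p (Cone-sign-aligned z∈C k) ⟩
    signQ k * z k          ∎
    where
    open ≡-Reasoning
    ∣sign∣≡1 : ∣ signQ k ∣ ≡ 1ℚ
    ∣sign∣≡1 with signOf-cases (proj₂ P01 x x-extreme k)
    ... | inj₁ (_ , sk≡1)  = cong ∣_∣ sk≡1
    ... | inj₂ (_ , sk≡-1) = cong ∣_∣ sk≡-1

  Cone-norm1 : ∀ {z} → Cone z → norm1 z ≡ inner signQ z
  Cone-norm1 z∈C = Σℚ-cong n (Cone-∣∣ z∈C)

  Cone-null : ∀ {z} → Cone z → inner signQ z ≡ 0ℚ → z ≗ zeroV
  Cone-null {z} z∈C s·z≡0 k =
    ∣p∣≡0⇒p≡0 (z k) (trans (Cone-∣∣ z∈C k) (Σℚ≡0⇒≡0 n (Cone-sign-aligned z∈C) s·z≡0 k))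

  tightRow : ∀ j → Dec (Tight x j) → Fin n → ℤ
  tightRow j (yes _) = B j
  tightRow j (no _)  = λ _ → + 0

  -- The slice { z ∈ Cone : signᵀz = 1 } as an LP; rows of inequalities not tight at x become 0 ≤ 0.
  coneSlice : LP n
  coneSlice = record
    { mA = suc mA ; A = sign ∷ A ; b = + 1 ∷ (λ _ → + 0)
    ; mB = mB ; B = λ j → tightRow j (tight? x j) ; d = λ _ → + 0
    ; c = c
    }

  slice⇒Cone : ∀ {z} → Feasible coneSlice z → Cone z × inner signQ z ≡ 1ℚ
  slice⇒Cone {z} (Az≡b , Bz≤0) = ((Az≡b ∘ suc) , below) , Az≡b zero
    where
    below : ∀ j → Tight x j → (B · z) j ≤ 0ℚ
    below j x-tight with tight? x j | Bz≤0 j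
    ... | yes _ | Bjz≤0 = Bjz≤0
    ... | no x-loose | _ = contradiction x-tight x-loose

  Cone⇒slice : ∀ {z} → Cone z → inner signQ z ≡ 1ℚ → Feasible coneSlice z
  Cone⇒slice {z} (Az≡0 , Bz≤0) s·z≡1 = Aeq , Ble
    where
    Aeq : ∀ i → (LP.A coneSlice · z) i ≡ ι (LP.b coneSlice i)
    Aeq zero    = s·z≡1
    Aeq (suc i) = Az≡0 i
    Ble : ∀ j → (LP.B coneSlice · z) j ≤ 0ℚ
    Ble j with tight? x j
    ... | yes x-tight = Bz≤0 j x-tight
    ... | no _ = ≤-reflexive (trans (inner-comm _ z) (Inner.vanishes z (λ _ → refl)))

  coneSlice-bounded : Bounded coneSlice
  coneSlice-bounded = 1ℚ , bound
    where
    bound : ∀ z → Feasible coneSlice z → ∀ k → ∣ z k ∣ ≤ 1ℚ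
    bound z z∈S k with slice⇒Cone z∈S
    ... | z∈C , s·z≡1 = subst₂ _≤_ (sym (Cone-∣∣ z∈C k)) s·z≡1 (term≤Σℚ n (Cone-sign-aligned z∈C) k)

  normalise : ∀ {z} → Cone z → (0<s·z : 0ℚ < inner signQ z) →
    Feasible coneSlice (1/pos (inner signQ z) 0<s·z ∙ᵥ z)
  normalise {z} z∈C 0<s·z = Cone⇒slice (Cone-scale N⁻¹ (<⇒≤ (1/pos-pos _ 0<s·z)) z∈C) (begin
    inner signQ (N⁻¹ ∙ᵥ z)   ≡⟨ Inner.scale signQ N⁻¹ z ⟩
    N⁻¹ * inner signQ z      ≡⟨ *-comm N⁻¹ _ ⟩
    inner signQ z * N⁻¹      ≡⟨ *-1/pos _ 0<s·z ⟩
    1ℚ                       ∎)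
    where
    open ≡-Reasoning
    N⁻¹ = 1/pos (inner signQ z) 0<s·z

  slice-vertex-split-interior : ∀ {v u u'} → ExtremePoint coneSlice v → Cone u → Cone u' → v ≗ u +ᵥ u' →
    (0<a : 0ℚ < inner signQ u) → 0ℚ < inner signQ u' → u ≗ inner signQ u ∙ᵥ v
  slice-vertex-split-interior {v} {u} {u'} (v∈S , v-extreme) u∈C u'∈C v≗u+u' 0<a 0<a' i = begin
    u i          ≡⟨ *-1/pos-cancel a 0<a (u i) ⟨
    a * û i      ≡⟨ cong (a *_) (v≗û i) ⟨
    a * v i      ∎
    where
    open ≡-Reasoning
    a = inner signQ u
    a' = inner signQ u'
    û = 1/pos a 0<a ∙ᵥ u
    û' = 1/pos a' 0<a' ∙ᵥ u'
    1-a≡a' : 1ℚ - a ≡ a'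
    1-a≡a' = begin
      1ℚ - a                 ≡⟨ cong (_- a) (proj₂ (slice⇒Cone v∈S)) ⟨
      inner signQ v - a      ≡⟨ cong (_- a) (trans (Inner.resp-≗ signQ v≗u+u') (Inner.additive signQ u u')) ⟩
      (a + a') - a           ≡⟨ solve 2 (λ a b → a :+ b :- a := b) refl a a' ⟩
      a'                     ∎
    v≗au+[1-a]û' : ∀ i → v i ≡ a * û i + (1ℚ - a) * û' i
    v≗au+[1-a]û' i = begin
      v i                                    ≡⟨ v≗u+u' i ⟩
      u i + u' i                             ≡⟨ cong₂ _+_ (*-1/pos-cancel a 0<a (u i)) (*-1/pos-cancel a' 0<a' (u' i)) ⟨
      a * û i + a' * û' i                    ≡⟨ cong (λ s → a * û i + s * û' i) 1-a≡a' ⟨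
      a * û i + (1ℚ - a) * û' i              ∎
    û≗û' : û ≗ û'
    û≗û' = v-extreme û û' a (normalise u∈C 0<a) (normalise u'∈C 0<a')
      0<a (0<q-p⇒p<q (subst (0ℚ <_) (sym 1-a≡a') 0<a')) v≗au+[1-a]û'
    v≗û : v ≗ û
    v≗û i = begin
      v i                         ≡⟨ v≗au+[1-a]û' i ⟩
      a * û i + (1ℚ - a) * û' i   ≡⟨ cong (λ s → a * û i + (1ℚ - a) * s) (û≗û' i) ⟨
      a * û i + (1ℚ - a) * û i    ≡⟨ solve 2 (λ a w → a :* w :+ (con 1ℚ :- a) :* w := w) refl a (û i) ⟩
      û i                         ∎

  slice-vertex-split : ∀ {v u u'} → ExtremePoint coneSlice v → Cone u → Cone u' → v ≗ u +ᵥ u' →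
    ∃[ μ ] (0ℚ ≤ μ × u ≗ μ ∙ᵥ v)
  slice-vertex-split {v} {u} {u'} v-vertex u∈C u'∈C v≗u+u' with inner signQ u ≟ 0ℚ | inner signQ u' ≟ 0ℚ
  ... | yes a≡0 | _ = 0ℚ , ≤-refl , λ i → trans (Cone-null u∈C a≡0 i) (sym (*-zeroˡ (v i)))
  ... | no _ | yes a'≡0 = 1ℚ , <⇒≤ (positive⁻¹ 1ℚ) , λ i → begin
    u i              ≡⟨ +-identityʳ (u i) ⟨
    u i + 0ℚ         ≡⟨ cong (λ s → u i + s) (Cone-null u'∈C a'≡0 i) ⟨
    u i + u' i       ≡⟨ v≗u+u' i ⟨
    v i              ≡⟨ *-identityˡ (v i) ⟨
    1ℚ * v i         ∎
    where open ≡-Reasoning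
  ... | no a≢0 | no a'≢0 = inner signQ u , <⇒≤ 0<a ,
    slice-vertex-split-interior v-vertex u∈C u'∈C v≗u+u' 0<a 0<a'
    where
    0<a = ≤∧≢⇒< (Σℚ-nonNeg n (Cone-sign-aligned u∈C)) (a≢0 ∘ sym)
    0<a' = ≤∧≢⇒< (Σℚ-nonNeg n (Cone-sign-aligned u'∈C)) (a'≢0 ∘ sym)

  slice-vertex⇒edge : ∀ {v} → ExtremePoint coneSlice v → EdgeDirection L x v
  slice-vertex⇒edge {v} v-vertex = v∈C , v≢0 , λ u u' u∈C u'∈C v≗u+u' →
    slice-vertex-split v-vertex u∈C u'∈C v≗u+u' ,
    slice-vertex-split v-vertex u'∈C u∈C (λ i → trans (v≗u+u' i) (+-comm (u i) (u' i)))
    where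
    v∈C = proj₁ (slice⇒Cone (proj₁ v-vertex))
    v≢0 : NonZeroV L v
    v≢0 v≗0 = 1≢0 (trans (sym (proj₂ (slice⇒Cone (proj₁ v-vertex)))) (Inner.vanishes signQ v≗0))

  module Steepest (g : Vecℚ n) (g-steepest : SteepestEdge L x g) where

    -- On Cone, φᵀz is the gap ‖g‖₁cᵀz − (cᵀg)‖z‖₁ in the steepest-edge inequality.
    φ : Vecℚ n
    φ j = norm1 g * ι (c j) + (- dot c g) * signQ j

    inner-φ : ∀ z → inner φ z ≡ norm1 g * dot c z + (- dot c g) * inner signQ z
    inner-φ = inner-linearˡ (norm1 g) (- dot c g) (λ j → ι (c j)) signQ

    0≤φ-at-slice-vertex : ∀ v → ExtremePoint coneSlice v → 0ℚ ≤ inner φ v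
    0≤φ-at-slice-vertex v v-vertex =
      subst (0ℚ ≤_) (sym (trans (inner-φ v) (cong (λ s → norm1 g * dot c v + (- dot c g) * s) s·v≡1)))
      (≤-by-difference (solve 3 (λ G C D → C :* G :- D :* con 1ℚ := G :* C :+ (:- D) :* con 1ℚ :- con 0ℚ)
                                refl (norm1 g) (dot c v) (dot c g))
        (subst (λ s → dot c g * s ≤ dot c v * norm1 g) ‖v‖≡1 (proj₂ g-steepest v v-edge)))
      where
      v-edge = slice-vertex⇒edge v-vertex
      s·v≡1 = proj₂ (slice⇒Cone (proj₁ v-vertex))
      ‖v‖≡1 : norm1 v ≡ 1ℚ
      ‖v‖≡1 = trans (Cone-norm1 (proj₁ v-edge)) s·v≡1

    steepest-on-cone : ∀ {z} → Cone z → dot c g * norm1 z ≤ norm1 g * dot c z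
    steepest-on-cone {z} z∈C with inner signQ z ≟ 0ℚ
    ... | yes s·z≡0 = ≤-reflexive (begin
      dot c g * norm1 z     ≡⟨ cong (dot c g *_) (trans (Cone-norm1 z∈C) s·z≡0) ⟩
      dot c g * 0ℚ          ≡⟨ *-zeroʳ (dot c g) ⟩
      0ℚ                    ≡⟨ *-zeroʳ (norm1 g) ⟨
      norm1 g * 0ℚ          ≡⟨ cong (norm1 g *_) (Inner.vanishes (λ j → ι (c j)) (Cone-null z∈C s·z≡0)) ⟨
      norm1 g * dot c z     ∎)
      where open ≡-Reasoning
    ... | no s·z≢0 = subst (λ s → dot c g * s ≤ norm1 g * dot c z) (sym (Cone-norm1 z∈C))
      (≤-by-difference (solve 4 (λ G C D N → G :* C :+ (:- D) :* N :- con 0ℚ := G :* C :- D :* N)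
                                refl (norm1 g) (dot c z) (dot c g) N)
        (subst (0ℚ ≤_) (inner-φ z) 0≤φz))
      where
      N = inner signQ z
      0<N : 0ℚ < N
      0<N = ≤∧≢⇒< (Σℚ-nonNeg n (Cone-sign-aligned z∈C)) (s·z≢0 ∘ sym)
      0≤φz : 0ℚ ≤ inner φ z
      0≤φz = *-cancelˡ-≤-0< (1/pos N 0<N) (1/pos-pos N 0<N)
        (subst₂ _≤_ (sym (*-zeroʳ (1/pos N 0<N))) (Inner.scale φ (1/pos N 0<N) z)
          (Polyhedron.vertex-bound coneSlice coneSlice-bounded (inner-linear φ) 0ℚ 0≤φ-at-slice-vertex
            (1/pos N 0<N ∙ᵥ z) (normalise z∈C 0<N)))

  module AlongEdge (g : Vecℚ n) (g-edge : EdgeDirection L x g) (α : ℚ) (αg-maximal : MaximalAugmentation L x α g) where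

    0<α : 0ℚ < α
    0<α = proj₁ αg-maximal

    α⁻¹ : ℚ
    α⁻¹ = 1/pos α 0<α

    x' : Vecℚ n
    x' = x +ᵥ (α ∙ᵥ g)

    nonzero-coordinate : ∃ λ k → g k ≢ 0ℚ
    nonzero-coordinate = ¬∀⟶∃¬ n _ (λ i → g i ≟ 0ℚ) (proj₁ (proj₂ g-edge))

    0<‖g‖ : 0ℚ < norm1 g
    0<‖g‖ = 0<norm1 (proj₁ nonzero-coordinate) (proj₂ nonzero-coordinate)

    multiples-of-g : ∀ {μ₁ μ₂} → g ≗ (μ₁ ∙ᵥ g) +ᵥ (μ₂ ∙ᵥ g) → μ₁ + μ₂ ≡ 1ℚ
    multiples-of-g {μ₁} {μ₂} g≗μ₁g+μ₂g = sym (q-p≡0⇒p≡q (*-cancelʳ-≡0 gk≢0 (begin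
      (μ₁ + μ₂ - 1ℚ) * g k           ≡⟨ solve 3 (λ a b g → (a :+ b :- con 1ℚ) :* g := (a :* g :+ b :* g) :- g)
                                                refl μ₁ μ₂ (g k) ⟩
      (μ₁ * g k + μ₂ * g k) - g k    ≡⟨ cong (_- g k) (g≗μ₁g+μ₂g k) ⟨
      g k - g k                      ≡⟨ +-inverseʳ (g k) ⟩
      0ℚ                             ∎)))
      where
      open ≡-Reasoning
      k = proj₁ nonzero-coordinate
      gk≢0 = proj₂ nonzero-coordinate

    toward : ∀ {y} λ' → 0ℚ < λ' → Feasible L y → Cone (α⁻¹ ∙ᵥ (λ' ∙ᵥ (y -ᵥ x)))
    toward λ' 0<λ y∈P = Cone-scale α⁻¹ (<⇒≤ (1/pos-pos α 0<α)) (Cone-scale λ' (<⇒≤ 0<λ) (Cone-difference y∈P))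

    split-at-x' : ∀ {y z λ'} → InOpenSegment y z λ' x' →
      g ≗ (α⁻¹ ∙ᵥ (λ' ∙ᵥ (y -ᵥ x))) +ᵥ (α⁻¹ ∙ᵥ ((1ℚ - λ') ∙ᵥ (z -ᵥ x)))
    split-at-x' {y} {z} {λ'} (_ , _ , x'≡) j = begin
      g j                                           ≡⟨ 1/pos-*-cancel α 0<α (g j) ⟨
      α⁻¹ * (α * g j)                               ≡⟨ cong (α⁻¹ *_) (step-difference x α g j) ⟨
      α⁻¹ * (x' j - x j)                            ≡⟨ cong (λ s → α⁻¹ * (s - x j)) (x'≡ j) ⟩
      α⁻¹ * ((λ' * y j + (1ℚ - λ') * z j) - x j)    ≡⟨ solve 5 (λ i l y z x → i :* ((l :* y :+ (con 1ℚ :- l) :* z) :- x)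
                                                                 := i :* (l :* (y :- x)) :+ i :* ((con 1ℚ :- l) :* (z :- x)))
                                                            refl α⁻¹ λ' (y j) (z j) (x j) ⟩
      α⁻¹ * (λ' * (y j - x j)) + α⁻¹ * ((1ℚ - λ') * (z j - x j)) ∎
      where open ≡-Reasoning

    on-ray : ∀ {y λ' μ} → 0ℚ < λ' → Feasible L y → α⁻¹ ∙ᵥ (λ' ∙ᵥ (y -ᵥ x)) ≗ μ ∙ᵥ g →
      ∃ λ t → t ≤ α × λ' * t ≡ α * μ × y ≗ x +ᵥ (t ∙ᵥ g)
    on-ray {y} {λ'} {μ} 0<λ y∈P direction = t , proj₂ (proj₂ αg-maximal) t (Feasible-resp-≗ y≗ y∈P) , λ't≡αμ , y≗
      where
      λ⁻¹ = 1/pos λ' 0<λ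
      t = α * μ * λ⁻¹
      λ't≡αμ : λ' * t ≡ α * μ
      λ't≡αμ = trans (solve 4 (λ l a m i → l :* (a :* m :* i) := (l :* i) :* (a :* m)) refl λ' α μ λ⁻¹)
        (trans (cong (_* (α * μ)) (*-1/pos λ' 0<λ)) (*-identityˡ (α * μ)))
      y≗ : y ≗ x +ᵥ (t ∙ᵥ g)
      y≗ i = begin
        y i                                          ≡⟨ solve 2 (λ y x → y := x :+ (y :- x)) refl (y i) (x i) ⟩
        x i + (y i - x i)                            ≡⟨ cong (λ s → x i + s) (1/pos-*-cancel λ' 0<λ (y i - x i)) ⟨
        x i + λ⁻¹ * (λ' * (y i - x i))               ≡⟨ cong (λ s → x i + λ⁻¹ * s) (*-1/pos-cancel α 0<α _) ⟨
        x i + λ⁻¹ * (α * (α⁻¹ * (λ' * (y i - x i)))) ≡⟨ cong (λ s → x i + λ⁻¹ * (α * s)) (direction i) ⟩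
        x i + λ⁻¹ * (α * (μ * g i))                  ≡⟨ cong (λ s → x i + s)
                                                          (solve 4 (λ i a m g → i :* (a :* (m :* g)) := a :* m :* i :* g)
                                                                 refl λ⁻¹ α μ (g i)) ⟩
        x i + t * g i                                ∎
        where open ≡-Reasoning

    -- Both ends of a segment through x' lie on the ray x + ℝ₊g, at most α from x, and
    -- average to α: so both are x'.
    x'-extreme : ExtremePoint L x'
    x'-extreme = proj₁ (proj₂ αg-maximal) , extreme
      where
      extreme : ∀ y z λ' → Feasible L y → Feasible L z → 0ℚ < λ' → λ' < 1ℚ →
        (∀ i → x' i ≡ λ' * y i + (1ℚ - λ') * z i) → ∀ i → y i ≡ z i
      extreme y z λ' y∈P z∈P 0<λ λ<1 x'≡ i = begin
        y i              ≡⟨ y≗ i ⟩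
        x i + t₁ * g i   ≡⟨ cong (λ s → x i + s * g i) (trans t₁≡α (sym t₂≡α)) ⟩
        x i + t₂ * g i   ≡⟨ z≗ i ⟨
        z i              ∎
        where
        open ≡-Reasoning
        segment = InOpenSegment-sym {y = y} {z} (0<λ , λ<1 , x'≡)
        split = proj₂ (proj₂ g-edge) _ _ (toward λ' 0<λ y∈P) (toward (1ℚ - λ') (proj₁ segment) z∈P)
                  (split-at-x' (0<λ , λ<1 , x'≡))
        μ₁ = proj₁ (proj₁ split)
        μ₂ = proj₁ (proj₂ split)
        ray₁ = on-ray 0<λ y∈P (proj₂ (proj₂ (proj₁ split)))
        ray₂ = on-ray (proj₁ segment) z∈P (proj₂ (proj₂ (proj₂ split)))
        t₁ = proj₁ ray₁
        t₂ = proj₁ ray₂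
        y≗ = proj₂ (proj₂ (proj₂ ray₁))
        z≗ = proj₂ (proj₂ (proj₂ ray₂))
        average : λ' * t₁ + (1ℚ - λ') * t₂ ≡ α
        average = begin
          λ' * t₁ + (1ℚ - λ') * t₂   ≡⟨ cong₂ _+_ (proj₁ (proj₂ (proj₂ ray₁))) (proj₁ (proj₂ (proj₂ ray₂))) ⟩
          α * μ₁ + α * μ₂            ≡⟨ *-distribˡ-+ α μ₁ μ₂ ⟨
          α * (μ₁ + μ₂)              ≡⟨ cong (α *_) (multiples-of-g {μ₁} {μ₂} (λ j → trans (split-at-x' (0<λ , λ<1 , x'≡) j)
                                          (cong₂ _+_ (proj₂ (proj₂ (proj₁ split)) j) (proj₂ (proj₂ (proj₂ split)) j)))) ⟩
          α * 1ℚ                     ≡⟨ *-identityʳ α ⟩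
          α                          ∎
        t₁≡α : t₁ ≡ α
        t₁≡α = average-pinned 0<λ λ<1 (proj₁ (proj₂ ray₁)) (proj₁ (proj₂ ray₂)) average
        t₂≡α : t₂ ≡ α
        t₂≡α = average-pinned (proj₁ segment) (proj₁ (proj₂ segment)) (proj₁ (proj₂ ray₂)) (proj₁ (proj₂ ray₁))
          (trans (solve 3 (λ l s t → (con 1ℚ :- l) :* t :+ (con 1ℚ :- (con 1ℚ :- l)) :* s := l :* s :+ (con 1ℚ :- l) :* t)
                          refl λ' t₁ t₂) average)

    1≤α‖g‖ : 1ℚ ≤ α * norm1 g
    1≤α‖g‖ = begin
      1ℚ                 ≡⟨ ∣q-p∣≡1 (proj₂ P01 x x-extreme k) (proj₂ P01 x' x'-extreme k) x'k-xk≢0 ⟨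
      ∣ x' k - x k ∣      ≡⟨ cong ∣_∣ (step-difference x α g k) ⟩
      ∣ α * g k ∣         ≡⟨ ∣p*q∣≡∣p∣*∣q∣ α (g k) ⟩
      ∣ α ∣ * ∣ g k ∣     ≡⟨ cong (_* ∣ g k ∣) (0≤p⇒∣p∣≡p (<⇒≤ 0<α)) ⟩
      α * ∣ g k ∣         ≤⟨ *-monoˡ-≤-0≤ α (<⇒≤ 0<α) (term≤Σℚ n (λ i → 0≤∣p∣ (g i)) k) ⟩
      α * norm1 g        ∎
      where
      open ≤-Reasoning
      k = proj₁ nonzero-coordinate
      x'k-xk≢0 : x' k - x k ≢ 0ℚ
      x'k-xk≢0 x'k-xk≡0 = proj₂ nonzero-coordinate
        (*-cancelˡ-≡0-pos 0<α (trans (sym (step-difference x α g k)) x'k-xk≡0))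

-- Used with G = ‖g‖₁, D = cᵀg, N = ‖y‖₁, Y = cᵀy, a = α and m = n.
approximation-inequality : ∀ {G D N Y a m} → 0ℚ < G → 0ℚ < N → N ≤ m → Y ≤ 0ℚ → 1ℚ ≤ a * G →
  D * N ≤ G * Y → - Y ≤ m * (- (a * D))
approximation-inequality {G} {D} {N} {Y} {a} {m} 0<G 0<N N≤m Y≤0 1≤aG DN≤GY with D ≤? 0ℚ
... | yes D≤0 = *-cancelˡ-≤-0< G 0<G (begin
  G * (- Y)              ≤⟨ ≤-by-difference (solve 4 (λ G Y D N → G :* Y :- D :* N := (:- D) :* N :- G :* (:- Y))
                                                    refl G Y D N) DN≤GY ⟩
  (- D) * N              ≤⟨ *-monoˡ-≤-0≤ (- D) 0≤-D N≤m ⟩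
  (- D) * m              ≡⟨ *-identityʳ ((- D) * m) ⟨
  (- D) * m * 1ℚ         ≤⟨ *-monoˡ-≤-0≤ ((- D) * m) (*-nonNeg 0≤-D (≤-trans (<⇒≤ 0<N) N≤m)) 1≤aG ⟩
  (- D) * m * (a * G)    ≡⟨ solve 4 (λ D m a G → (:- D) :* m :* (a :* G) := G :* (m :* (:- (a :* D)))) refl D m a G ⟩
  G * (m * (- (a * D)))  ∎)
  where
  open ≤-Reasoning
  0≤-D = p≤0⇒0≤-p D≤0
... | no D≰0 = ⊥-elim (<-irrefl refl (<-≤-trans 0<N (*-cancelˡ-≤-0< D (≰⇒> D≰0) (begin
  D * N      ≤⟨ DN≤GY ⟩
  G * Y      ≤⟨ *-monoˡ-≤-0≤ G (<⇒≤ 0<G) Y≤0 ⟩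
  G * 0ℚ     ≡⟨ *-zeroʳ G ⟩
  0ℚ         ≡⟨ *-zeroʳ D ⟨
  D * 0ℚ     ∎))))
  where open ≤-Reasoning

theorem4 : ∀ {n : ℕ} (L : LP n) → FullRowRankA L → RankStackedN L → ZeroOnePolytope L →
    ∀ (x : Vecℚ n) → ExtremePoint L x →
    ∀ (g : Vecℚ n) (α : ℚ) → SteepestEdge L x g → MaximalAugmentation L x α g →
    ApproxGreatestImprovement L (ι (+ n)) x α g
theorem4 {n} L _ _ P01 x x-extreme g α g-steepest αg-maximal α* g* g*-greatest = begin
  improvement L x α* (ιᵥ g*)       ≡⟨ improvement-≡ x α* (ιᵥ g*) ⟩
  - (α* * dot c (ιᵥ g*))           ≡⟨ cong -_ (dot-step x α* (ιᵥ g*)) ⟨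
  - dot c y                        ≤⟨ approximation-inequality {D = dot c g} {a = α}
                                        0<‖g‖ (greatest-step-nonzero {g* = g*} g*-greatest) (norm1-difference≤n step∈P x∈P)
                                        (greatest-step-descends {g* = g*} x∈P g*-greatest) 1≤α‖g‖
                                        (steepest-on-cone (Cone-difference step∈P)) ⟩
  ι (+ n) * - (α * dot c g)        ≡⟨ cong (ι (+ n) *_) (improvement-≡ x α g) ⟨
  ι (+ n) * improvement L x α g    ∎
  where
  open ≤-Reasoning
  open LP L
  open Polyhedron L
  open ZeroOne L P01
  open VertexCone L P01 x x-extreme
  open Steepest g g-steepest
  open AlongEdge g (proj₁ g-steepest) α αg-maximal
  step∈P : Feasible L (x +ᵥ (α* ∙ᵥ ιᵥ g*))
  step∈P = proj₁ (proj₂ (proj₂ g*-greatest))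
  y : Vecℚ n
  y = (x +ᵥ (α* ∙ᵥ ιᵥ g*)) -ᵥ x
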